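{- Let \[F_3(t,x)=x^6+12x^5+48x^4+64x^3-(324t^2+108)x^2-(1296t^2+432)x-1296t^2-432.\] Let $v\in\mathbb Q\setminus\{1,-1\}$ and $c=\dfrac{v^3-9v}{9(1-v^2)}$. Then $F_3(c,x)$ has a root in $\mathbb Q$ if and only if $v$ equals one of \[1+2w^2,\qquad -1-2w^2,\qquad \frac{2w}{1+w^2}\] for some $w\in\mathbb Q$. -}

module Defs where

open import Data.Rational using (ℚ; mkℚ; _+_; _*_; _-_; -_; _÷_; _/_; NonZero; NonNegative; Positive; 0ℚ; 1ℚ)
open import Data.Rational.Properties using (nonNeg*nonNeg⇒nonNeg; nonPos*nonPos⇒nonPos; pos+nonNeg⇒pos; pos⇒nonZero)
open import Data.Integer using (+_; -[1+_])

lit : _ → ℚ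
lit n = (+ n) / 1

F₃ : ℚ → ℚ → ℚ
F₃ t x =
  x * x * x * x * x * x
  + lit 12 * (x * x * x * x * x)
  + lit 48 * (x * x * x * x)
  + lit 64 * (x * x * x)
  - (lit 324 * (t * t) + lit 108) * (x * x)
  - (lit 1296 * (t * t) + lit 432) * x
  - lit 1296 * (t * t)
  - lit 432

den : ℚ → ℚ
den v = lit 9 * (1ℚ - v * v)

cOf : (v : ℚ) → .{{_ : NonZero (den v)}} → ℚ
cOf v = (v * v * v - lit 9 * v) ÷ den v

sq-nonNeg : (w : ℚ) → NonNegative (w * w)
sq-nonNeg w@(mkℚ (+ _) _ _) = nonNeg*nonNeg⇒nonNeg w w
sq-nonNeg w@(mkℚ -[1+ _ ] _ _) = nonPos*nonPos⇒nonPos w w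

1+sq-nonZero : (w : ℚ) → NonZero (1ℚ + w * w)
1+sq-nonZero w = pos⇒nonZero (1ℚ + w * w) {{pos+nonNeg⇒pos 1ℚ (w * w) {{sq-nonNeg w}}}}

thirdForm : ℚ → ℚ
thirdForm w = (lit 2 * w) ÷ (1ℚ + w * w)
  where instance _ = 1+sq-nonZero w

-- With y = x + 2 one has F₃(t, x) = (y² − 4)³ − 108(1 + 3t²)y², and for t = c(v) this
-- splits over ℚ, up to the factor 81 / (9(1 − v²))², into three quadratics in y:
-- (1 − v)y² + 2(1 + v)², (1 + v)y² + 2(1 − v)² and (1 − v²)y² − 16.
-- Each has the shape a y² + k b² with a, k, b ≠ 0, and the substitution w = b / y shows that it
-- has a rational root iff a + k w² = 0 has one. For the first two factors this reads
-- v = ±(1 + 2w²); for the third it says that (u, v) lies on the unit circle for some rational u,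
-- and the rational points of the circle are (u, 2w / (1 + w²)) where w is the slope of the line
-- through (−1, 0) and the point.
module Submission where

open import Defs
open import Data.Rational using (ℚ; _+_; _-_; _*_; -_; NonZero; 0ℚ; 1ℚ)
open import Data.Product using (∃)
open import Data.Sum using (_⊎_)
open import Function.Bundles using (_⇔_)
open import Relation.Binary.PropositionalEquality using (_≡_; _≢_)

open import Data.List.Base using (_∷_; [])
open import Data.Product using (_,_)
import Data.Product.Function.Dependent.Propositional as Σ
open import Data.Rational using (_÷_; 1/_; ≢-nonZero)
open import Data.Rational.Properties
  using (_≟_; +-*-commutativeRing; heytingCommutativeRing; +-0-group
        ; +-comm; *-assoc; *-comm; *-identityʳ; *-inverseˡ; *-inverseʳ; *-zeroˡ; *-zeroʳ)
open import Algebra.Apartness.Properties.HeytingCommutativeRing heytingCommutativeRing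
  using (x#0y#0→xy#0)
open import Algebra.Properties.Group +-0-group using (x∙y⁻¹≈ε⇒x≈y; x≈y⇒x∙y⁻¹≈ε)
open import Data.Sum using (inj₁; inj₂; [_,_]′)
open import Data.Sum.Function.Propositional using (_⊎-⇔_)
open import Function.Base using (id)
open import Function.Bundles using (_↔_; mk⇔; mk↔ₛ′; Equivalence)
open import Function.Construct.Composition using (_⇔-∘_)
open import Function.Construct.Identity using (⇔-id)
open import Function.Construct.Symmetry using (⇔-sym)
open import Function.Properties.Inverse using (↔⇒⇔)
open import Function.Related.TypeIsomorphisms using (Σ-distribˡ-⊎)
open import Level using (0ℓ)
open import Relation.Binary.PropositionalEquality using (refl; sym; trans; cong; cong₂; module ≡-Reasoning)
open import Relation.Nullary using (yes; no; contradiction)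
open import Relation.Nullary.Decidable using (dec⇒maybe)
open import Tactic.RingSolver using (solve)
open import Tactic.RingSolver.Core.AlmostCommutativeRing using (AlmostCommutativeRing; fromCommutativeRing)

open Equivalence using (to)

ℚ-ring : AlmostCommutativeRing 0ℓ 0ℓ
ℚ-ring = fromCommutativeRing +-*-commutativeRing (λ p → dec⇒maybe (0ℚ ≟ p))

nonZero⇒≢0 : ∀ p → .{{NonZero p}} → p ≢ 0ℚ
nonZero⇒≢0 p {{()}} refl

p*q≡0⇒p≡0∨q≡0 : ∀ p q → p * q ≡ 0ℚ → p ≡ 0ℚ ⊎ q ≡ 0ℚ
p*q≡0⇒p≡0∨q≡0 p q pq≡0 with p ≟ 0ℚ | q ≟ 0ℚ
... | yes p≡0 | _       = inj₁ p≡0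
... | no _    | yes q≡0 = inj₂ q≡0
... | no p≢0  | no q≢0  = contradiction pq≡0 (x#0y#0→xy#0 p≢0 q≢0)

p≢0⇒p*q≡0⇒q≡0 : ∀ {p q} → p ≢ 0ℚ → p * q ≡ 0ℚ → q ≡ 0ℚ
p≢0⇒p*q≡0⇒q≡0 {p} {q} p≢0 pq≡0 with p*q≡0⇒p≡0∨q≡0 p q pq≡0
... | inj₁ p≡0 = contradiction p≡0 p≢0
... | inj₂ q≡0 = q≡0

p*[q*r]≡0⇔ : ∀ p q r → p * (q * r) ≡ 0ℚ ⇔ (p ≡ 0ℚ ⊎ q ≡ 0ℚ ⊎ r ≡ 0ℚ)
p*[q*r]≡0⇔ p q r = mk⇔ split merge
  where
  split : p * (q * r) ≡ 0ℚ → p ≡ 0ℚ ⊎ q ≡ 0ℚ ⊎ r ≡ 0ℚ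
  split pqr≡0 with p*q≡0⇒p≡0∨q≡0 p (q * r) pqr≡0
  ... | inj₁ p≡0  = inj₁ p≡0
  ... | inj₂ qr≡0 = inj₂ (p*q≡0⇒p≡0∨q≡0 q r qr≡0)

  merge : p ≡ 0ℚ ⊎ q ≡ 0ℚ ⊎ r ≡ 0ℚ → p * (q * r) ≡ 0ℚ
  merge (inj₁ refl)        = *-zeroˡ (q * r)
  merge (inj₂ (inj₁ refl)) = trans (cong (p *_) (*-zeroˡ r)) (*-zeroʳ p)
  merge (inj₂ (inj₂ refl)) = trans (cong (p *_) (*-zeroʳ q)) (*-zeroʳ p)

a*p≡b*q⇒p≡0⇔q≡0 : ∀ {a b p q} → a ≢ 0ℚ → b ≢ 0ℚ → a * p ≡ b * q → p ≡ 0ℚ ⇔ q ≡ 0ℚ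
a*p≡b*q⇒p≡0⇔q≡0 {a} {b} a≢0 b≢0 ap≡bq = mk⇔
  (λ p≡0 → p≢0⇒p*q≡0⇒q≡0 b≢0 (trans (sym ap≡bq) (trans (cong (a *_) p≡0) (*-zeroʳ a))))
  (λ q≡0 → p≢0⇒p*q≡0⇒q≡0 a≢0 (trans ap≡bq (trans (cong (b *_) q≡0) (*-zeroʳ b))))

p÷q*q≡p : ∀ p q .{{_ : NonZero q}} → (p ÷ q) * q ≡ p
p÷q*q≡p p q = begin
  p * 1/ q * q     ≡⟨ *-assoc p (1/ q) q ⟩
  p * (1/ q * q)   ≡⟨ cong (p *_) (*-inverseˡ q) ⟩
  p * 1ℚ           ≡⟨ *-identityʳ p ⟩
  p                ∎
  where open ≡-Reasoning

p*q≡r⇒p≡r÷q : ∀ {p q r} .{{_ : NonZero q}} → p * q ≡ r → p ≡ r ÷ q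
p*q≡r⇒p≡r÷q {p} {q} {r} pq≡r = begin
  p                ≡⟨ *-identityʳ p ⟨
  p * 1ℚ           ≡⟨ cong (p *_) (*-inverseʳ q) ⟨
  p * (q * 1/ q)   ≡⟨ *-assoc p q (1/ q) ⟨
  p * q * 1/ q     ≡⟨ cong (_* 1/ q) pq≡r ⟩
  r * 1/ q         ∎
  where open ≡-Reasoning

q-p≡0⇔p≡q : ∀ {e} p q → e ≡ q - p → e ≡ 0ℚ ⇔ p ≡ q
q-p≡0⇔p≡q p q refl = mk⇔ (λ q-p≡0 → sym (x∙y⁻¹≈ε⇒x≈y q p q-p≡0)) (λ p≡q → x≈y⇒x∙y⁻¹≈ε (sym p≡q))

+-translation : ℚ → ℚ ↔ ℚ
+-translation c = mk↔ₛ′ (_+ c) (_- c) (λ y → solve (y ∷ c ∷ []) ℚ-ring) (λ x → solve (x ∷ c ∷ []) ℚ-ring)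

∃-distrib-⊎₃ : ∀ {A : Set} {P Q R : A → Set} → (∃ λ a → P a ⊎ Q a ⊎ R a) ⇔ (∃ P ⊎ ∃ Q ⊎ ∃ R)
∃-distrib-⊎₃ = (⇔-id _ ⊎-⇔ ↔⇒⇔ Σ-distribˡ-⊎) ⇔-∘ ↔⇒⇔ Σ-distribˡ-⊎

conic : ℚ → ℚ → ℚ → ℚ → ℚ
conic a k b y = a * (y * y) + k * (b * b)

conic-rescale : ∀ a k w y {b} → w * y ≡ b → (y * y) * (a + k * (w * w)) ≡ conic a k b y
conic-rescale a k w y refl = begin
  (y * y) * (a + k * (w * w))           ≡⟨ solve (a ∷ k ∷ w ∷ y ∷ []) ℚ-ring ⟩
  a * (y * y) + k * ((w * y) * (w * y)) ∎
  where open ≡-Reasoning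

conic-root⇔ : ∀ {a k b} → a ≢ 0ℚ → k ≢ 0ℚ → b ≢ 0ℚ →
  (∃ λ y → conic a k b y ≡ 0ℚ) ⇔ (∃ λ w → a + k * (w * w) ≡ 0ℚ)
conic-root⇔ {a} {k} {b} a≢0 k≢0 b≢0 = mk⇔ rescale unscale
  where
  open ≡-Reasoning

  rescale : (∃ λ y → conic a k b y ≡ 0ℚ) → ∃ λ w → a + k * (w * w) ≡ 0ℚ
  rescale (y , conic≡0) = b ÷ y , p≢0⇒p*q≡0⇒q≡0 (x#0y#0→xy#0 y≢0 y≢0)
                                    (trans (conic-rescale a k (b ÷ y) y (p÷q*q≡p b y)) conic≡0)
    where
    y≢0 : y ≢ 0ℚ
    y≢0 refl = x#0y#0→xy#0 k≢0 (x#0y#0→xy#0 b≢0 b≢0) (begin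
      k * (b * b)                 ≡⟨ solve (a ∷ k ∷ b ∷ []) ℚ-ring ⟩
      a * (0ℚ * 0ℚ) + k * (b * b) ≡⟨ conic≡0 ⟩
      0ℚ                          ∎)

    instance
      y-nonZero : NonZero y
      y-nonZero = ≢-nonZero y≢0

  unscale : (∃ λ w → a + k * (w * w) ≡ 0ℚ) → ∃ λ y → conic a k b y ≡ 0ℚ
  unscale (w , form≡0) = y , (begin
    conic a k b y               ≡⟨ conic-rescale a k w y (trans (*-comm w y) (p÷q*q≡p b w)) ⟨
    (y * y) * (a + k * (w * w)) ≡⟨ cong (y * y *_) form≡0 ⟩
    (y * y) * 0ℚ                ≡⟨ *-zeroʳ (y * y) ⟩
    0ℚ                          ∎)
    where
    w≢0 : w ≢ 0ℚ
    w≢0 refl = a≢0 (begin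
      a                 ≡⟨ solve (a ∷ k ∷ []) ℚ-ring ⟩
      a + k * (0ℚ * 0ℚ) ≡⟨ form≡0 ⟩
      0ℚ                ∎)

    instance
      w-nonZero : NonZero w
      w-nonZero = ≢-nonZero w≢0

    y : ℚ
    y = b ÷ w

chord-identity : ∀ u w {v} → w * (1ℚ + u) ≡ v →
  (1ℚ + u) * (1ℚ + u) * (v * (1ℚ + w * w) - lit 2 * w) ≡ v * (u * u + v * v - 1ℚ)
chord-identity u w refl = solve (u ∷ w ∷ []) ℚ-ring

on-unit-circle : ∀ u v w → u * (1ℚ + w * w) ≡ 1ℚ - w * w → v * (1ℚ + w * w) ≡ lit 2 * w →
  u * u + v * v ≡ 1ℚ
on-unit-circle u v w us vs = x∙y⁻¹≈ε⇒x≈y _ _ (p≢0⇒p*q≡0⇒q≡0 (x#0y#0→xy#0 s≢0 s≢0) (begin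
  (1ℚ + w * w) * (1ℚ + w * w) * (u * u + v * v - 1ℚ)
    ≡⟨ solve (u ∷ v ∷ w ∷ []) ℚ-ring ⟩
  (u * (1ℚ + w * w)) * (u * (1ℚ + w * w)) + (v * (1ℚ + w * w)) * (v * (1ℚ + w * w))
    - (1ℚ + w * w) * (1ℚ + w * w)
    ≡⟨ cong₂ (λ p q → p * p + q * q - (1ℚ + w * w) * (1ℚ + w * w)) us vs ⟩
  (1ℚ - w * w) * (1ℚ - w * w) + (lit 2 * w) * (lit 2 * w) - (1ℚ + w * w) * (1ℚ + w * w)
    ≡⟨ solve (w ∷ []) ℚ-ring ⟩
  0ℚ ∎))
  where
  open ≡-Reasoning
  s≢0 : 1ℚ + w * w ≢ 0ℚ
  s≢0 = nonZero⇒≢0 (1ℚ + w * w) {{1+sq-nonZero w}}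

unit-circle⇔thirdForm : ∀ v → (∃ λ u → u * u + v * v ≡ 1ℚ) ⇔ (∃ λ w → v ≡ thirdForm w)
unit-circle⇔thirdForm v = mk⇔ slope point
  where
  open ≡-Reasoning

  slope : (∃ λ u → u * u + v * v ≡ 1ℚ) → ∃ λ w → v ≡ thirdForm w
  slope (u , on-circle) with 1ℚ + u ≟ 0ℚ
  ... | yes 1+u≡0 = 0ℚ , [ id , id ]′ (p*q≡0⇒p≡0∨q≡0 v v (begin
    v * v                                      ≡⟨ solve (u ∷ v ∷ []) ℚ-ring ⟩
    (u * u + v * v) - 1ℚ - (u - 1ℚ) * (1ℚ + u) ≡⟨ cong₂ (λ r s → r - 1ℚ - (u - 1ℚ) * s) on-circle 1+u≡0 ⟩
    1ℚ - 1ℚ - (u - 1ℚ) * 0ℚ                    ≡⟨ solve (u ∷ []) ℚ-ring ⟩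
    0ℚ                                         ∎))
  ... | no 1+u≢0 = w , p*q≡r⇒p≡r÷q {{1+sq-nonZero w}} (x∙y⁻¹≈ε⇒x≈y _ _
          (p≢0⇒p*q≡0⇒q≡0 (x#0y#0→xy#0 1+u≢0 1+u≢0) (begin
            (1ℚ + u) * (1ℚ + u) * (v * (1ℚ + w * w) - lit 2 * w)
              ≡⟨ chord-identity u w (p÷q*q≡p v (1ℚ + u)) ⟩
            v * (u * u + v * v - 1ℚ)
              ≡⟨ cong (λ r → v * (r - 1ℚ)) on-circle ⟩
            v * 0ℚ
              ≡⟨ *-zeroʳ v ⟩
            0ℚ ∎)))
    where
    instance
      1+u-nonZero : NonZero (1ℚ + u)
      1+u-nonZero = ≢-nonZero 1+u≢0

    w : ℚ
    w = v ÷ (1ℚ + u)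

  point : (∃ λ w → v ≡ thirdForm w) → ∃ λ u → u * u + v * v ≡ 1ℚ
  point (w , refl) = u ,
    on-unit-circle u (thirdForm w) w (p÷q*q≡p (1ℚ - w * w) (1ℚ + w * w)) (p÷q*q≡p (lit 2 * w) (1ℚ + w * w))
    where
    instance
      1+w²-nonZero : NonZero (1ℚ + w * w)
      1+w²-nonZero = 1+sq-nonZero w

    u : ℚ
    u = (1ℚ - w * w) ÷ (1ℚ + w * w)

F₃-shifted : ∀ t x → let y = x + lit 2 in
  F₃ t x ≡ (y * y - lit 4) * (y * y - lit 4) * (y * y - lit 4) - lit 108 * (1ℚ + lit 3 * (t * t)) * (y * y)
F₃-shifted t x = begin
  F₃ t x
    ≡⟨⟩
  x * x * x * x * x * x
    + lit 12 * (x * x * x * x * x)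
    + lit 48 * (x * x * x * x)
    + lit 64 * (x * x * x)
    - (lit 324 * (t * t) + lit 108) * (x * x)
    - (lit 1296 * (t * t) + lit 432) * x
    - lit 1296 * (t * t)
    - lit 432
    ≡⟨ solve (t ∷ x ∷ []) ℚ-ring ⟩
  ((x + lit 2) * (x + lit 2) - lit 4) * ((x + lit 2) * (x + lit 2) - lit 4) * ((x + lit 2) * (x + lit 2) - lit 4)
    - lit 108 * (1ℚ + lit 3 * (t * t)) * ((x + lit 2) * (x + lit 2))
    ∎
  where open ≡-Reasoning

cleared-F₃-shifted : ∀ v t y → den v * t ≡ v * v * v - lit 9 * v →
  den v * den v * ((y * y - lit 4) * (y * y - lit 4) * (y * y - lit 4) - lit 108 * (1ℚ + lit 3 * (t * t)) * (y * y))
  ≡ lit 81 * (conic (1ℚ - v) (lit 2) (1ℚ + v) y * (conic (1ℚ + v) (lit 2) (1ℚ - v) y * conic (1ℚ - v * v) (- 1ℚ) (lit 4) y))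
cleared-F₃-shifted v t y dt≡n = begin
  lit 9 * (1ℚ - v * v) * (lit 9 * (1ℚ - v * v))
    * ((y * y - lit 4) * (y * y - lit 4) * (y * y - lit 4) - lit 108 * (1ℚ + lit 3 * (t * t)) * (y * y))
    ≡⟨ solve (v ∷ t ∷ y ∷ []) ℚ-ring ⟩
  lit 81 * ((1ℚ - v * v) * (1ℚ - v * v)) * ((y * y - lit 4) * (y * y - lit 4) * (y * y - lit 4))
    - lit 108 * (y * y) * (lit 9 * (1ℚ - v * v) * (lit 9 * (1ℚ - v * v))
                           + lit 3 * ((lit 9 * (1ℚ - v * v) * t) * (lit 9 * (1ℚ - v * v) * t)))
    ≡⟨ cong (λ n → lit 81 * ((1ℚ - v * v) * (1ℚ - v * v)) * ((y * y - lit 4) * (y * y - lit 4) * (y * y - lit 4))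
                   - lit 108 * (y * y) * (lit 9 * (1ℚ - v * v) * (lit 9 * (1ℚ - v * v)) + lit 3 * (n * n))) dt≡n ⟩
  lit 81 * ((1ℚ - v * v) * (1ℚ - v * v)) * ((y * y - lit 4) * (y * y - lit 4) * (y * y - lit 4))
    - lit 108 * (y * y) * (lit 9 * (1ℚ - v * v) * (lit 9 * (1ℚ - v * v))
                           + lit 3 * ((v * v * v - lit 9 * v) * (v * v * v - lit 9 * v)))
    -- the bracket is 3(v² + 3)³
    ≡⟨ solve (v ∷ y ∷ []) ℚ-ring ⟩
  lit 81 * (((1ℚ - v) * (y * y) + lit 2 * ((1ℚ + v) * (1ℚ + v)))
          * (((1ℚ + v) * (y * y) + lit 2 * ((1ℚ - v) * (1ℚ - v)))
          * ((1ℚ - v * v) * (y * y) + (- 1ℚ) * (lit 4 * lit 4))))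
    ∎
  where open ≡-Reasoning

F₃-factorisation : ∀ v x .{{_ : NonZero (den v)}} → let y = x + lit 2 in
  den v * den v * F₃ (cOf v) x
  ≡ lit 81 * (conic (1ℚ - v) (lit 2) (1ℚ + v) y * (conic (1ℚ + v) (lit 2) (1ℚ - v) y * conic (1ℚ - v * v) (- 1ℚ) (lit 4) y))
F₃-factorisation v x = trans (cong (den v * den v *_) (F₃-shifted (cOf v) x))
  (cleared-F₃-shifted v (cOf v) (x + lit 2) (trans (*-comm (den v) (cOf v)) (p÷q*q≡p _ (den v))))

F₃-root⇔ : ∀ v x .{{_ : NonZero (den v)}} → let y = x + lit 2 in
  F₃ (cOf v) x ≡ 0ℚ ⇔
  (conic (1ℚ - v) (lit 2) (1ℚ + v) y ≡ 0ℚ ⊎ conic (1ℚ + v) (lit 2) (1ℚ - v) y ≡ 0ℚ ⊎ conic (1ℚ - v * v) (- 1ℚ) (lit 4) y ≡ 0ℚ)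
F₃-root⇔ v x = p*[q*r]≡0⇔ _ _ _ ⇔-∘ a*p≡b*q⇒p≡0⇔q≡0 {b = lit 81} den²≢0 (λ ()) (F₃-factorisation v x)
  where
  den²≢0 : den v * den v ≢ 0ℚ
  den²≢0 = x#0y#0→xy#0 (nonZero⇒≢0 (den v)) (nonZero⇒≢0 (den v))

module _ {v : ℚ} (v≢1 : v ≢ 1ℚ) (v≢-1 : v ≢ - 1ℚ) where

  1-v≢0 : 1ℚ - v ≢ 0ℚ
  1-v≢0 1-v≡0 = v≢1 (to (q-p≡0⇔p≡q v 1ℚ refl) 1-v≡0)

  1+v≢0 : 1ℚ + v ≢ 0ℚ
  1+v≢0 1+v≡0 = v≢-1 (sym (to (q-p≡0⇔p≡q (- 1ℚ) v (+-comm 1ℚ v)) 1+v≡0))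

  1-v²≢0 : 1ℚ - v * v ≢ 0ℚ
  1-v²≢0 1-v²≡0 = x#0y#0→xy#0 1-v≢0 1+v≢0 (begin
    (1ℚ - v) * (1ℚ + v) ≡⟨ solve (v ∷ []) ℚ-ring ⟩
    1ℚ - v * v          ≡⟨ 1-v²≡0 ⟩
    0ℚ                  ∎)
    where open ≡-Reasoning

  roots⇔1+2w² : (∃ λ y → conic (1ℚ - v) (lit 2) (1ℚ + v) y ≡ 0ℚ) ⇔ (∃ λ w → v ≡ 1ℚ + lit 2 * (w * w))
  roots⇔1+2w² =
    Σ.congˡ (λ {w} → q-p≡0⇔p≡q {1ℚ - v + lit 2 * (w * w)} v (1ℚ + lit 2 * (w * w)) (solve (v ∷ w ∷ []) ℚ-ring))
    ⇔-∘ conic-root⇔ {k = lit 2} 1-v≢0 (λ ()) 1+v≢0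

  roots⇔-1-2w² : (∃ λ y → conic (1ℚ + v) (lit 2) (1ℚ - v) y ≡ 0ℚ) ⇔ (∃ λ w → v ≡ (- 1ℚ) - lit 2 * (w * w))
  roots⇔-1-2w² =
    Σ.congˡ (λ {w} → mk⇔ sym sym ⇔-∘ q-p≡0⇔p≡q {1ℚ + v + lit 2 * (w * w)} ((- 1ℚ) - lit 2 * (w * w)) v (solve (v ∷ w ∷ []) ℚ-ring))
    ⇔-∘ conic-root⇔ {k = lit 2} 1+v≢0 (λ ()) 1-v≢0

  roots⇔thirdForm : (∃ λ y → conic (1ℚ - v * v) (- 1ℚ) (lit 4) y ≡ 0ℚ) ⇔ (∃ λ w → v ≡ thirdForm w)
  roots⇔thirdForm = unit-circle⇔thirdForm v
    ⇔-∘ (Σ.congˡ (λ {u} → q-p≡0⇔p≡q {1ℚ - v * v + (- 1ℚ) * (u * u)} (u * u + v * v) 1ℚ (solve (u ∷ v ∷ []) ℚ-ring))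
    ⇔-∘ conic-root⇔ {k = - 1ℚ} {lit 4} 1-v²≢0 (λ ()) (λ ()))

lemma4p11 : (v : ℚ) → v ≢ 1ℚ → v ≢ - 1ℚ → .{{_ : NonZero (den v)}} →
    (∃ λ (x : ℚ) → F₃ (cOf v) x ≡ 0ℚ) ⇔
    (∃ λ (w : ℚ) → (v ≡ 1ℚ + lit 2 * (w * w)) ⊎ (v ≡ (- 1ℚ) - lit 2 * (w * w)) ⊎ (v ≡ thirdForm w))
lemma4p11 v v≢1 v≢-1 =
  ⇔-sym ∃-distrib-⊎₃
  ⇔-∘ ((roots⇔1+2w² v≢1 v≢-1 ⊎-⇔ roots⇔-1-2w² v≢1 v≢-1 ⊎-⇔ roots⇔thirdForm v≢1 v≢-1)
  ⇔-∘ (∃-distrib-⊎₃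
  ⇔-∘ Σ.cong (+-translation (lit 2)) (λ {x} → F₃-root⇔ v x)))
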